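{- Let $k=3^{\alpha}5^{\beta}$ where $\alpha,\beta\geq 0$ are integers with $\alpha+\beta\geq 1$. Then $$ s((\mathbb{Z}_k)^3)\leq 300k-299 \quad\text{and}\quad \eta((\mathbb{Z}_k)^3)\leq 299k-298. $$
   Context: For a finite Abelian group $A$, $\exp(A)$ denotes its exponent, and a sequence over $A$ means a finite multiset of elements of $A$. $s(A)$ is the smallest integer $\ell$ such that every sequence over $A$ of length at least $\ell$ has a subsequence of length exactly $\exp(A)$ whose elements sum to $0$. $\eta(A)$ is the smallest integer $\ell$ such that every sequence over $A$ of length at least $\ell$ has a nonempty subsequence of length at most $\exp(A)$ whose elements sum to $0$. -}

module Defs where

open import Data.Nat using (ℕ; _+_; _*_; _≤_; _^_)
open import Data.Nat.Divisibility using (_∣_)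
open import Data.Fin using (Fin; toℕ)
open import Data.List using (List; length; map)
open import Data.Nat.ListAction using (sum)
open import Data.List.Relation.Binary.Sublist.Propositional using (_⊆_)
open import Data.Product using (_×_; ∃-syntax)
open import Relation.Binary.PropositionalEquality using (_≡_)

-- The group (ℤ_k)^3: elements are triples of residues mod k,
-- represented as functions Fin 3 → Fin k (canonical representatives 0..k-1).
Zk3 : ℕ → Set
Zk3 k = Fin 3 → Fin k

-- A sequence over (ℤ_k)^3 (a finite multiset) is represented as a list;
-- a subsequence is a sublist.
-- Zero-sum in (ℤ_k)^3: every coordinate sum is ≡ 0 (mod k).
ZeroSum : (k : ℕ) → List (Zk3 k) → Set
ZeroSum k T = ∀ (i : Fin 3) → k ∣ sum (map (λ g → toℕ (g i)) T)

-- The exponent of (ℤ_k)^3 is k (for k ≥ 1).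
-- SProp k ℓ : every sequence of length ≥ ℓ has a zero-sum subsequence of length exactly exp = k.
SProp : ℕ → ℕ → Set
SProp k ℓ = ∀ (S : List (Zk3 k)) → ℓ ≤ length S →
  ∃[ T ] (T ⊆ S × length T ≡ k × ZeroSum k T)

EtaProp : ℕ → ℕ → Set
EtaProp k ℓ = ∀ (S : List (Zk3 k)) → ℓ ≤ length S →
  ∃[ T ] (T ⊆ S × 1 ≤ length T × length T ≤ k × ZeroSum k T)

IsLeast : (ℕ → Set) → ℕ → Set
IsLeast P ℓ = P ℓ × (∀ m → P m → ℓ ≤ m)

IsS : ℕ → ℕ → Set
IsS k = IsLeast (SProp k)

IsEta : ℕ → ℕ → Set
IsEta k = IsLeast (EtaProp k)

-- Pigeonhole on the n^d residue classes modulo n gives s((ℤ_n)^d) ≤ n^d (n − 1) + 1, hence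
-- s((ℤ_k)^3) ≤ 299 (k − 1) + 1 for k = 1, 3, 5. This linear bound is preserved under products:
-- from a sequence of length (s_m − 1) n + s_n over (ℤ_mn)^d one extracts, one after another,
-- s_m disjoint zero-sum blocks of length n; their sums divided by n form a sequence over
-- (ℤ_m)^d, and the blocks of one of its zero-sum subsequences of length m together form a
-- zero-sum subsequence of length mn. So s((ℤ_k)^3) ≤ 299k − 298 ≤ 300k − 299 for every
-- k = 3^α 5^β, and η((ℤ_k)^3) ≤ 299k − 298 as well, a zero-sum subsequence of length k
-- being one of length at most k. Both properties are decidable, so s and η exist as least
-- elements.
module Submission where

open import Defs
open import Data.Nat using (ℕ; zero; suc; _+_; _*_; _∸_; _≤_; _<_; _^_; z≤n; s≤s; NonZero; _≟_; _≤?_)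
open import Data.Nat.Properties
  using (≤-reflexive; ≤-trans; n≤1+n; m≤n+m; +-identityʳ; +-monoˡ-≤; +-cancelˡ-≤; +-assoc; +-suc;
         *-assoc; *-monoˡ-≤; *-distribʳ-+; m+n∸m≡n; m≤n⇒m⊓n≡m; ≤∧≢⇒<; <⇒≤pred; ≰⇒>; ≮⇒≥;
         module ≤-Reasoning)
open import Data.Nat.Divisibility using (_∣_; _∣?_; ∣m∣n⇒∣m+n; m∣m*n; n∣m*n; *-monoˡ-∣)
open import Data.Nat.DivMod using (_%_; _/_; m≡m%n+[m/n]*n; m%n<n; m/n*n≡m)
open import Data.Nat.ListAction using (sum)
open import Data.Nat.ListAction.Properties using (sum-++; sum-↭)
open import Data.Nat.Tactic.RingSolver using (solve-∀)
open import Data.Fin using (Fin; zero; suc; toℕ; fromℕ; fromℕ<)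
open import Data.Fin.Properties
  using (all?; ¬∀⟶∃¬-smallest; toℕ-fromℕ; toℕ-fromℕ<; toℕ-inject; toℕ≤pred[n])
open import Data.Vec using (Vec; []; _∷_; toList; fromList; lookup; tabulate)
open import Data.Vec.Properties using (length-toList; toList∘fromList; lookup∘tabulate)
import Data.Vec.Functional as Vector
open import Data.List using (List; []; _∷_; _++_; length; map; take; concat)
open import Data.List.Properties using (length-map; length-++; length-take; map-++; map-∘; map-cong)
open import Data.List.Relation.Unary.All as All using (All; []; _∷_)
open import Data.List.Relation.Binary.Sublist.Propositional
  using (_⊆_; []; _∷_; _∷ʳ_; ⊆-trans; minimum)
open import Data.List.Relation.Binary.Sublist.Propositional.Properties using (All-resp-⊆; take-⊆)
open import Data.List.Relation.Binary.Permutation.Propositional using (_↭_; ↭-refl; ↭-trans)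
open import Data.List.Relation.Binary.Permutation.Propositional.Properties
  using (↭-length; ++⁺ˡ) renaming (map⁺ to ↭-map⁺)
open import Data.List.Relation.Ternary.Interleaving.Propositional
  using (Interleaving; []; consˡ; consʳ; toPermutation; swap)
open import Data.List.Relation.Ternary.Interleaving.Properties using (interleave-length)
open import Data.Product using (_×_; _,_; proj₁; proj₂; ∃; ∃-syntax; ∃₂)
open import Data.Sum using (_⊎_; inj₁; inj₂; [_,_])
open import Function using (_∘_)
open import Relation.Nullary using (Dec; yes; no; ¬_; ¬?; contradiction)
open import Relation.Nullary.Decidable using (map′; _×-dec_; _⊎-dec_; from-yes; decidable-stable)
open import Relation.Unary using (Decidable)
open import Relation.Binary.PropositionalEquality
  using (_≡_; refl; sym; trans; cong; cong₂; subst; module ≡-Reasoning)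

private
  variable
    A : Set
    c d k m n ℓ : ℕ
    xs ys zs : List A

coordSum : (A → Fin d → ℕ) → List A → Fin d → ℕ
coordSum f xs i = sum (map (λ x → f x i) xs)

ZeroSumMod : ℕ → (A → Fin d → ℕ) → List A → Set
ZeroSumMod n f xs = ∀ i → n ∣ coordSum f xs i

-- s((ℤ_n)^d) ≤ ℓ, for sequences of arbitrary elements labelled by vectors in ℕ^d: the
-- multiplicativity argument applies the bound for ℤ_m to a sequence of blocks.
SBound : ℕ → ℕ → ℕ → Set₁
SBound d n ℓ = ∀ {A : Set} (f : A → Fin d → ℕ) xs → ℓ ≤ length xs →
               ∃[ ys ] (ys ⊆ xs × length ys ≡ n × ZeroSumMod n f ys)

sBound-mono : ℓ ≤ m → SBound d n ℓ → SBound d n m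
sBound-mono ℓ≤m sb f xs m≤ = sb f xs (≤-trans ℓ≤m m≤)

interleaving-⊆ˡ : Interleaving xs ys zs → xs ⊆ zs
interleaving-⊆ˡ [] = []
interleaving-⊆ˡ (consˡ sp) = refl ∷ interleaving-⊆ˡ sp
interleaving-⊆ˡ {zs = z ∷ _} (consʳ sp) = z ∷ʳ interleaving-⊆ˡ sp

interleaving-⊆ʳ : Interleaving xs ys zs → ys ⊆ zs
interleaving-⊆ʳ = interleaving-⊆ˡ ∘ swap

⊆⇒interleaving : xs ⊆ zs → ∃[ ys ] Interleaving xs ys zs
⊆⇒interleaving [] = [] , []
⊆⇒interleaving (z ∷ʳ τ) = let ys , sp = ⊆⇒interleaving τ in z ∷ ys , consʳ sp
⊆⇒interleaving (refl ∷ τ) = let ys , sp = ⊆⇒interleaving τ in ys , consˡ sp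

interleaving-shrinkʳ : Interleaving xs ys zs → ∀ {ys′} → ys′ ⊆ ys →
                       ∃[ zs′ ] (zs′ ⊆ zs × Interleaving xs ys′ zs′)
interleaving-shrinkʳ [] [] = [] , [] , []
interleaving-shrinkʳ {xs = x ∷ _} (consˡ sp) τ =
  let zs′ , σ , sp′ = interleaving-shrinkʳ sp τ in x ∷ zs′ , refl ∷ σ , consˡ sp′
interleaving-shrinkʳ (consʳ sp) (y ∷ʳ τ) =
  let zs′ , σ , sp′ = interleaving-shrinkʳ sp τ in zs′ , y ∷ʳ σ , sp′
interleaving-shrinkʳ (consʳ sp) (refl ∷ τ) =
  let zs′ , σ , sp′ = interleaving-shrinkʳ sp τ in _ , refl ∷ σ , consʳ sp′

interleaving-partition : {P : A → Set} → Decidable P → ∀ zs →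
  ∃₂ λ xs ys → Interleaving xs ys zs × All P xs × All (¬_ ∘ P) ys
interleaving-partition P? [] = [] , [] , [] , [] , []
interleaving-partition P? (z ∷ zs) with interleaving-partition P? zs | P? z
... | xs , ys , sp , pxs , ¬pys | yes pz = z ∷ xs , ys , consˡ sp , pz ∷ pxs , ¬pys
... | xs , ys , sp , pxs , ¬pys | no ¬pz = xs , z ∷ ys , consʳ sp , pxs , ¬pz ∷ ¬pys

⊆-ofLength : n ≤ length xs → ∃[ ys ] (ys ⊆ xs × length ys ≡ n)
⊆-ofLength {n} {xs = xs} n≤ = take n xs , take-⊆ n xs , trans (length-take n xs) (m≤n⇒m⊓n≡m n≤)

pigeonhole : ∀ N (colour : A → ℕ) {L} xs → All (λ x → colour x < N) xs → N * L < length xs →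
             ∃[ c ] ∃[ ys ] (ys ⊆ xs × length ys ≡ suc L × All (λ x → colour x ≡ c) ys)
pigeonhole zero colour (x ∷ xs) (() ∷ _) big
pigeonhole (suc N) colour {L} xs bounded big
  with interleaving-partition (λ x → colour x ≟ N) xs
... | ys , zs , sp , ys≡N , zs≢N with suc L ≤? length ys
...   | yes enough =
  let ys′ , ys′⊆ys , |ys′| = ⊆-ofLength enough
  in N , ys′ , ⊆-trans ys′⊆ys (interleaving-⊆ˡ sp) , |ys′| , All-resp-⊆ ys′⊆ys ys≡N
...   | no few =
  let c , ys′ , ys′⊆zs , |ys′| , same = pigeonhole N colour zs zs<N many
  in c , ys′ , ⊆-trans ys′⊆zs (interleaving-⊆ʳ sp) , |ys′| , same
  where
  zs<N : All (λ x → colour x < N) zs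
  zs<N = All.zipWith (λ (<1+N , ≢N) → ≤∧≢⇒< (<⇒≤pred <1+N) ≢N)
                     (All-resp-⊆ (interleaving-⊆ʳ sp) bounded , zs≢N)
  many : N * L < length zs
  many = +-cancelˡ-≤ L _ _ (begin
    L + suc (N * L)          ≡⟨ +-suc L (N * L) ⟩
    suc L + N * L            ≤⟨ big ⟩
    length xs                ≡⟨ interleave-length sp ⟩
    length ys + length zs    ≤⟨ +-monoˡ-≤ (length zs) (≮⇒≥ few) ⟩
    L + length zs            ∎)
    where open ≤-Reasoning

⊆-sameResidues : ∀ d n .{{_ : NonZero n}} (f : A → Fin d → ℕ) {L} xs → n ^ d * L < length xs →
  ∃[ ys ] (ys ⊆ xs × length ys ≡ suc L × ∃ λ (r : Fin d → ℕ) → All (λ x → ∀ i → f x i % n ≡ r i) ys)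
⊆-sameResidues zero n f {L} xs big
  with ys , ys⊆xs , |ys| ← ⊆-ofLength (subst (_< length xs) (+-identityʳ L) big)
  = ys , ys⊆xs , |ys| , (λ ()) , All.universal (λ _ ()) ys
⊆-sameResidues (suc d) n f {L} xs big
  with r₀ , ys , ys⊆xs , |ys| , same₀ ←
         pigeonhole n (λ x → f x zero % n) xs (All.universal (λ x → m%n<n (f x zero) n) xs)
                    (subst (_< length xs) (*-assoc n (n ^ d) L) big)
  with zs , zs⊆ys , |zs| , r , same ←
         ⊆-sameResidues d n (λ x i → f x (suc i)) ys (≤-reflexive (sym |ys|))
  = zs , ⊆-trans zs⊆ys ys⊆xs , |zs| , r₀ Vector.∷ r ,
    All.zipWith (λ (≡r₀ , ≡r) → λ { zero → ≡r₀ ; (suc i) → ≡r i }) (All-resp-⊆ zs⊆ys same₀ , same)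

sum-sameResidue : .{{_ : NonZero n}} (g : A → ℕ) {r : ℕ} → All (λ x → g x % n ≡ r) xs →
                  ∃[ q ] sum (map g xs) ≡ length xs * r + q * n
sum-sameResidue g [] = 0 , refl
sum-sameResidue {n = n} {xs = x ∷ xs} g {r} (gx≡r ∷ rest) =
  let q , eq = sum-sameResidue g rest in g x / n + q , (begin
    g x + sum (map g xs)                             ≡⟨ cong₂ _+_ (m≡m%n+[m/n]*n (g x) n) eq ⟩
    (g x % n + g x / n * n) + (length xs * r + q * n) ≡⟨ cong (λ s → (s + g x / n * n) + _) gx≡r ⟩
    (r + g x / n * n) + (length xs * r + q * n)      ≡⟨ regroup r (g x / n) (length xs) q n ⟩
    (r + length xs * r) + (g x / n + q) * n          ∎)
  where
  open ≡-Reasoning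
  regroup : ∀ r p l q n → (r + p * n) + (l * r + q * n) ≡ (r + l * r) + (p + q) * n
  regroup = solve-∀

sameResidue⇒∣sum : .{{_ : NonZero n}} (g : A → ℕ) {r : ℕ} → length xs ≡ n →
                   All (λ x → g x % n ≡ r) xs → n ∣ sum (map g xs)
sameResidue⇒∣sum {n = n} g {r} |xs| same =
  let q , eq = sum-sameResidue g same
  in subst (n ∣_) (sym eq) (∣m∣n⇒∣m+n (subst (λ l → n ∣ l * r) (sym |xs|) (m∣m*n r)) (n∣m*n q))

sBound-pigeonhole : ∀ d n → SBound d (suc n) (suc (suc n ^ d * n))
sBound-pigeonhole d n f xs big =
  let ys , ys⊆xs , |ys| , r , same = ⊆-sameResidues d (suc n) f xs big
  in ys , ys⊆xs , |ys| , λ i → sameResidue⇒∣sum (λ x → f x i) |ys| (All.map (λ ≡r → ≡r i) same)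

data DisjointSublists {A : Set} : List A → List (List A) → Set where
  []  : ∀ {xs} → DisjointSublists xs []
  _∷_ : ∀ {xs B R Bs} → Interleaving B R xs → DisjointSublists R Bs → DisjointSublists xs (B ∷ Bs)

disjointSublists-concat : ∀ {Bs Cs} → DisjointSublists xs Bs → Cs ⊆ Bs →
                          ∃[ ys ] (ys ⊆ xs × ys ↭ concat Cs)
disjointSublists-concat {xs = xs} [] [] = [] , minimum xs , ↭-refl
disjointSublists-concat (sp ∷ disj) (_ ∷ʳ Cs⊆Bs) =
  let ys , ys⊆R , ys↭ = disjointSublists-concat disj Cs⊆Bs
  in ys , ⊆-trans ys⊆R (interleaving-⊆ʳ sp) , ys↭
disjointSublists-concat (_∷_ {B = B} sp disj) (refl ∷ Cs⊆Bs) =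
  let ys , ys⊆R , ys↭ = disjointSublists-concat disj Cs⊆Bs
      zs , zs⊆xs , sp′ = interleaving-shrinkʳ sp ys⊆R
  in zs , zs⊆xs , ↭-trans (toPermutation sp′) (++⁺ˡ B ys↭)

zeroSumBlocks : SBound d n ℓ → (f : A → Fin d → ℕ) → ∀ j xs → j * n + ℓ ≤ length xs →
  ∃[ Bs ] (DisjointSublists xs Bs × length Bs ≡ suc j ×
           All (λ B → length B ≡ n × ZeroSumMod n f B) Bs)
zeroSumBlocks {n = n} {ℓ = ℓ} sb f j xs big
  with B , B⊆xs , |B| , zs ← sb f xs (≤-trans (m≤n+m ℓ (j * n)) big)
  with R , sp ← ⊆⇒interleaving B⊆xs
  with j
... | zero = B ∷ [] , sp ∷ [] , refl , (|B| , zs) ∷ []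
... | suc j′ =
  let Bs , disj , |Bs| , good = zeroSumBlocks sb f j′ R rest
  in B ∷ Bs , sp ∷ disj , cong suc |Bs| , (|B| , zs) ∷ good
  where
  rest : j′ * n + ℓ ≤ length R
  rest = +-cancelˡ-≤ n _ _ (begin
    n + (j′ * n + ℓ)      ≡⟨ +-assoc n (j′ * n) ℓ ⟨
    suc j′ * n + ℓ        ≤⟨ big ⟩
    length xs             ≡⟨ interleave-length sp ⟩
    length B + length R   ≡⟨ cong (_+ length R) |B| ⟩
    n + length R          ∎)
    where open ≤-Reasoning

length-concat-uniform : ∀ {Cs : List (List A)} → All (λ C → length C ≡ n) Cs →
                        length (concat Cs) ≡ length Cs * n
length-concat-uniform [] = refl
length-concat-uniform {Cs = C ∷ _} (|C| ∷ rest) =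
  trans (length-++ C) (cong₂ _+_ |C| (length-concat-uniform rest))

coordSum-++ : (f : A → Fin d → ℕ) (xs ys : List A) (i : Fin d) →
              coordSum f (xs ++ ys) i ≡ coordSum f xs i + coordSum f ys i
coordSum-++ f xs ys i =
  trans (cong sum (map-++ (λ x → f x i) xs ys)) (sum-++ (map (λ x → f x i) xs) _)

coordSum-↭ : (f : A → Fin d → ℕ) → xs ↭ ys → ∀ i → coordSum f xs i ≡ coordSum f ys i
coordSum-↭ f xs↭ys i = sum-↭ (↭-map⁺ (λ x → f x i) xs↭ys)

blockQuotients : ∀ n .{{_ : NonZero n}} → (A → Fin d → ℕ) → List A → Fin d → ℕ
blockQuotients n f B i = coordSum f B i / n

coordSum-concat : .{{_ : NonZero n}} (f : A → Fin d → ℕ) {Cs : List (List A)} →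
                  All (ZeroSumMod n f) Cs →
                  ∀ i → coordSum f (concat Cs) i ≡ coordSum (blockQuotients n f) Cs i * n
coordSum-concat f [] i = refl
coordSum-concat {n = n} f {C ∷ Cs} (zs ∷ rest) i = begin
  coordSum f (C ++ concat Cs) i
    ≡⟨ coordSum-++ f C (concat Cs) i ⟩
  coordSum f C i + coordSum f (concat Cs) i
    ≡⟨ cong₂ _+_ (sym (m/n*n≡m (zs i))) (coordSum-concat f rest i) ⟩
  coordSum f C i / n * n + coordSum (blockQuotients n f) Cs i * n
    ≡⟨ *-distribʳ-+ n (coordSum f C i / n) _ ⟨
  coordSum (blockQuotients n f) (C ∷ Cs) i * n
    ∎
  where open ≡-Reasoning

sBound-* : .{{_ : NonZero n}} → ∀ {a} → SBound d m (suc a) → SBound d n ℓ →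
           SBound d (m * n) (a * n + ℓ)
sBound-* {n = n} {m = m} {a = a} sm sn f xs big =
  let Bs , disj , |Bs| , good = zeroSumBlocks sn f a xs big
      Cs , Cs⊆Bs , |Cs| , zsCs = sm (blockQuotients n f) Bs (≤-reflexive (sym |Bs|))
      ys , ys⊆xs , ys↭Cs = disjointSublists-concat disj Cs⊆Bs
      goodCs = All-resp-⊆ Cs⊆Bs good
  in ys , ys⊆xs ,
     trans (↭-length ys↭Cs)
           (trans (length-concat-uniform (All.map proj₁ goodCs)) (cong (_* n) |Cs|)) ,
     λ i → subst (m * n ∣_)
                 (sym (trans (coordSum-↭ f ys↭Cs i) (coordSum-concat f (All.map proj₂ goodCs) i)))
                 (*-monoˡ-∣ n (zsCs i))

-- s((ℤ_k)^d) ≤ c (k − 1) + 1, indexed by suc k so that a product of two indices computes to a successor.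
data LinearSBound (d c : ℕ) : ℕ → Set₁ where
  linear : ∀ {k} → SBound d (suc k) (suc (c * k)) → LinearSBound d c (suc k)

linearSBound-mono : ∀ {c′} → c ≤ c′ → LinearSBound d c k → LinearSBound d c′ k
linearSBound-mono c≤c′ (linear {k} sb) = linear (sBound-mono (s≤s (*-monoˡ-≤ k c≤c′)) sb)

linearSBound-* : LinearSBound d c m → LinearSBound d c n → LinearSBound d c (m * n)
linearSBound-* {c = c} (linear {m} sm) (linear {n} sn) =
  linear (sBound-mono (≤-reflexive (regroup c m n)) (sBound-* sm sn))
  where
  regroup : ∀ c m n → c * m * suc n + suc (c * n) ≡ suc (c * (n + m * suc n))
  regroup = solve-∀

linearSBound-^ : LinearSBound d c 1 → LinearSBound d c k → ∀ α → LinearSBound d c (k ^ α)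
linearSBound-^ one _ zero = one
linearSBound-^ one bk (suc α) = linearSBound-* bk (linearSBound-^ one bk α)

linearSBound-pigeonhole : ∀ d n → suc n ^ d ≤ c → LinearSBound d c (suc n)
linearSBound-pigeonhole d n ≤c = linearSBound-mono ≤c (linear (sBound-pigeonhole d n))

linearSBound-3^α5^β : ∀ α β → LinearSBound 3 299 (3 ^ α * 5 ^ β)
linearSBound-3^α5^β α β = linearSBound-* (linearSBound-^ one three α) (linearSBound-^ one five β)
  where
  one : LinearSBound 3 299 1
  one = linearSBound-pigeonhole 3 0 (from-yes (1 ≤? 299))
  three : LinearSBound 3 299 3
  three = linearSBound-pigeonhole 3 2 (from-yes (27 ≤? 299))
  five : LinearSBound 3 299 5
  five = linearSBound-pigeonhole 3 4 (from-yes (125 ≤? 299))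

Searchable : Set → Set₁
Searchable A = ∀ {P : A → Set} → Decidable P → Dec (∀ x → P x)

searchable-Vec : Searchable A → ∀ n → Searchable (Vec A n)
searchable-Vec search zero P? = map′ (λ P[] → λ { [] → P[] }) (λ ∀P → ∀P []) (P? [])
searchable-Vec search (suc n) P? =
  map′ (λ ∀P → λ { (x ∷ xs) → ∀P x xs }) (λ ∀P x xs → ∀P (x ∷ xs))
       (search (λ x → searchable-Vec search n (λ xs → P? (x ∷ xs))))

∃-⊆? : {Q : List A → Set} → Decidable Q → ∀ xs → Dec (∃[ ys ] (ys ⊆ xs × Q ys))
∃-⊆? Q? [] = map′ (λ q → [] , [] , q) (λ { (.[] , [] , q) → q }) (Q? [])
∃-⊆? {Q = Q} Q? (x ∷ xs) =
  map′ [ skip , keep ] split (∃-⊆? Q? xs ⊎-dec ∃-⊆? (Q? ∘ (x ∷_)) xs)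
  where
  skip : ∃[ ys ] (ys ⊆ xs × Q ys) → ∃[ ys ] (ys ⊆ x ∷ xs × Q ys)
  skip (ys , τ , q) = ys , x ∷ʳ τ , q
  keep : ∃[ ys ] (ys ⊆ xs × Q (x ∷ ys)) → ∃[ ys ] (ys ⊆ x ∷ xs × Q ys)
  keep (ys , τ , q) = x ∷ ys , refl ∷ τ , q
  split : ∃[ ys ] (ys ⊆ x ∷ xs × Q ys) →
          ∃[ ys ] (ys ⊆ xs × Q ys) ⊎ ∃[ ys ] (ys ⊆ xs × Q (x ∷ ys))
  split (ys , .x ∷ʳ τ , q) = inj₁ (ys , τ , q)
  split (.x ∷ ys , refl ∷ τ , q) = inj₂ (ys , τ , q)

⊆-map⁻ : ∀ {B : Set} (h : A → B) {zs} xs → zs ⊆ map h xs → ∃[ ys ] (ys ⊆ xs × map h ys ≡ zs)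
⊆-map⁻ h [] [] = [] , [] , refl
⊆-map⁻ h (x ∷ xs) (_ ∷ʳ τ) = let ys , σ , eq = ⊆-map⁻ h xs τ in ys , x ∷ʳ σ , eq
⊆-map⁻ h (x ∷ xs) (refl ∷ τ) =
  let ys , σ , eq = ⊆-map⁻ h xs τ in x ∷ ys , refl ∷ σ , cong (h x ∷_) eq

toList-surjective : (xs : List A) → length xs ≡ n → ∃[ v ] (toList {n = n} v ≡ xs)
toList-surjective xs refl = fromList xs , toList∘fromList xs

-- Sequences over X need not be enumerable (X = Fin 3 → Fin k is not, up to ≡), but if Q cannot
-- tell a sequence from its image under ι ∘ π, it suffices to search the sequences over Y.
∀∃-⊆? : ∀ {X Y : Set} → Searchable Y → (π : X → Y) (ι : Y → X) →
        {Q : List X → Set} → Decidable Q → (∀ ys → Q (map (ι ∘ π) ys) → Q ys) →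
        ∀ ℓ → Dec (∀ xs → ℓ ≤ length xs → ∃[ ys ] (ys ⊆ xs × Q ys))
∀∃-⊆? search π ι {Q} Q? Q-resp ℓ =
  map′ fromY toY (searchable-Vec search ℓ (λ v → ∃-⊆? Q? (map ι (toList v))))
  where
  toY : (∀ xs → ℓ ≤ length xs → ∃[ ys ] (ys ⊆ xs × Q ys)) →
        ∀ v → ∃[ ys ] (ys ⊆ map ι (toList v) × Q ys)
  toY h v = h (map ι (toList v))
              (≤-reflexive (sym (trans (length-map ι (toList v)) (length-toList v))))
  fromY : (∀ v → ∃[ ys ] (ys ⊆ map ι (toList v) × Q ys)) →
          ∀ xs → ℓ ≤ length xs → ∃[ ys ] (ys ⊆ xs × Q ys)
  fromY h xs ℓ≤ =
    let xs₀ , xs₀⊆xs , |xs₀| = ⊆-ofLength ℓ≤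
        v , v≡ = toList-surjective (map π xs₀) (trans (length-map π xs₀) |xs₀|)
        zs , zs⊆ , Qzs = h v
        ys , ys⊆xs₀ , ys≡ = ⊆-map⁻ (ι ∘ π) xs₀
                              (subst (zs ⊆_) (trans (cong (map ι) v≡) (sym (map-∘ xs₀))) zs⊆)
    in ys , ⊆-trans ys⊆xs₀ xs₀⊆xs , Q-resp ys (subst Q (sym ys≡) Qzs)

zeroSum? : ∀ k T → Dec (ZeroSum k T)
zeroSum? k T = all? (λ i → k ∣? _)

zeroSum-lookup∘tabulate : ∀ {k} T → ZeroSum k (map (λ g → lookup (tabulate g)) T) → ZeroSum k T
zeroSum-lookup∘tabulate {k} T zs i = subst (k ∣_) (cong sum coords) (zs i)
  where
  coords : map (λ g → toℕ (g i)) (map (λ g → lookup (tabulate g)) T) ≡ map (λ g → toℕ (g i)) T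
  coords = trans (sym (map-∘ T)) (map-cong (λ g → cong toℕ (lookup∘tabulate g i)) T)

sProp? : ∀ k ℓ → Dec (SProp k ℓ)
sProp? k = ∀∃-⊆? (searchable-Vec all? 3) tabulate lookup
  (λ T → (length T ≟ k) ×-dec zeroSum? k T)
  (λ T (|T| , zs) → trans (sym (length-map _ T)) |T| , zeroSum-lookup∘tabulate T zs)

etaProp? : ∀ k ℓ → Dec (EtaProp k ℓ)
etaProp? k = ∀∃-⊆? (searchable-Vec all? 3) tabulate lookup
  (λ T → (1 ≤? length T) ×-dec (length T ≤? k) ×-dec zeroSum? k T)
  (λ T (1≤ , ≤k , zs) → subst (1 ≤_) (length-map _ T) 1≤ , subst (_≤ k) (length-map _ T) ≤k ,
                        zeroSum-lookup∘tabulate T zs)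

least : {P : ℕ → Set} → Decidable P → ∀ {n} → P n → ∃[ s ] (IsLeast P s × s ≤ n)
least {P} P? {n} Pn
  with i , ¬¬Pi , below ← ¬∀⟶∃¬-smallest (suc n) (λ i → ¬ P (toℕ i)) (λ i → ¬? (P? (toℕ i)))
                            (λ ∀¬P → ∀¬P (fromℕ n) (subst P (sym (toℕ-fromℕ n)) Pn))
  = toℕ i , (decidable-stable (P? (toℕ i)) ¬¬Pi , minimal) , toℕ≤pred[n] i
  where
  minimal : ∀ m → P m → toℕ i ≤ m
  minimal m Pm with toℕ i ≤? m
  ... | yes i≤m = i≤m
  ... | no i≰m =
    contradiction (subst P (sym (trans (toℕ-inject j) (toℕ-fromℕ< m<i))) Pm) (below j)
    where
    m<i : m < toℕ i
    m<i = ≰⇒> i≰m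
    j : Fin (toℕ i)
    j = fromℕ< m<i

*-suc-∸ : ∀ c k → suc c * suc k ∸ c ≡ suc (suc c * k)
*-suc-∸ c k = trans (cong (_∸ c) (regroup c k)) (m+n∸m≡n c (suc (suc c * k)))
  where
  regroup : ∀ c k → suc c * suc k ≡ c + suc (suc c * k)
  regroup = solve-∀

linearSBound⇒bounds : ∀ {c k} → LinearSBound 3 (suc c) k →
  (∃[ s ] (IsS k s × s ≤ suc (suc c) * k ∸ suc c)) × (∃[ e ] (IsEta k e × e ≤ suc c * k ∸ c))
linearSBound⇒bounds {c} (linear {k} sb) =
  let s , isS , s≤ = least (sProp? (suc k)) sProp
      e , isEta , e≤ = least (etaProp? (suc k)) etaProp
  in (s , isS , ≤-trans s≤ ℓ≤) , (e , isEta , subst (e ≤_) (sym (*-suc-∸ c k)) e≤)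
  where
  ℓ≤ : suc (suc c * k) ≤ suc (suc c) * suc k ∸ suc c
  ℓ≤ = subst (suc (suc c * k) ≤_) (sym (*-suc-∸ (suc c) k))
             (s≤s (*-monoˡ-≤ k (n≤1+n (suc c))))
  sProp : SProp (suc k) (suc (suc c * k))
  sProp = sb (λ g i → toℕ (g i))
  etaProp : EtaProp (suc k) (suc (suc c * k))
  etaProp S big =
    let T , T⊆S , |T| , zs = sProp S big
    in T , T⊆S , subst (1 ≤_) (sym |T|) (s≤s z≤n) , ≤-reflexive |T| , zs

mainTheorem7 : ∀ (α β : ℕ) → 1 ≤ α + β →
    (∃[ s ] (IsS (3 ^ α * 5 ^ β) s × s ≤ 300 * (3 ^ α * 5 ^ β) ∸ 299))
    × (∃[ e ] (IsEta (3 ^ α * 5 ^ β) e × e ≤ 299 * (3 ^ α * 5 ^ β) ∸ 298))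
mainTheorem7 α β _ = linearSBound⇒bounds (linearSBound-3^α5^β α β)
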